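{- Let $(A,\rightarrow,\rightsquigarrow,1)$ be a pseudo-BE(A) algebra, let $D$ be a fantastic deductive system of $A$ and let $E$ be a deductive system of $A$ with $D\subseteq E$. Then $E$ is a fantastic deductive system of $A$.
   Context: A pseudo-BE algebra is an algebra $(A,\rightarrow,\rightsquigarrow,1)$ of type $(2,2,0)$ such that for all $x,y,z\in A$: $x\rightarrow x=x\rightsquigarrow x=1$; $x\rightarrow 1=x\rightsquigarrow 1=1$; $1\rightarrow x=1\rightsquigarrow x=x$; $x\rightarrow(y\rightsquigarrow z)=y\rightsquigarrow(x\rightarrow z)$; $x\rightarrow y=1$ iff $x\rightsquigarrow y=1$. Write $x\le y$ iff $x\rightarrow y=1$. It is a pseudo-BE(A) algebra if $x\le y$ implies $y\rightarrow z\le x\rightarrow z$ and $y\rightsquigarrow z\le x\rightsquigarrow z$ for all $z$. Put $x\vee_1 y=(x\rightarrow y)\rightsquigarrow y$, $x\vee_2 y=(x\rightsquigarrow y)\rightarrow y$. A deductive system is $D\subseteq A$ with $1\in D$ such that $x\in D$, $x\rightarrow y\in D$ imply $y\in D$. It is fantastic if for all $x,y$: $y\rightarrow x\in D$ implies $(x\vee_1 y)\rightarrow x\in D$, and $y\rightsquigarrow x\in D$ implies $(x\vee_2 y)\rightsquigarrow x\in D$. -}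

module Defs where

open import Level using (Level; _⊔_; suc)
open import Relation.Binary.PropositionalEquality using (_≡_)
open import Data.Product using (_×_)
open import Function.Bundles using (_⇔_)

record PseudoBE (a : Level) : Set (suc a) where
  infixr 5 _⇒_ _⇝_
  field
    Carrier : Set a
    _⇒_ : Carrier → Carrier → Carrier
    _⇝_ : Carrier → Carrier → Carrier
    𝟙 : Carrier
    ⇒-refl : ∀ x → (x ⇒ x) ≡ 𝟙
    ⇝-refl : ∀ x → (x ⇝ x) ≡ 𝟙
    ⇒-top : ∀ x → (x ⇒ 𝟙) ≡ 𝟙
    ⇝-top : ∀ x → (x ⇝ 𝟙) ≡ 𝟙
    ⇒-left : ∀ x → (𝟙 ⇒ x) ≡ x
    ⇝-left : ∀ x → (𝟙 ⇝ x) ≡ x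
    exchange : ∀ x y z → (x ⇒ (y ⇝ z)) ≡ (y ⇝ (x ⇒ z))
    ⇒⇔⇝ : ∀ x y → ((x ⇒ y) ≡ 𝟙) ⇔ ((x ⇝ y) ≡ 𝟙)

  _≤_ : Carrier → Carrier → Set a
  x ≤ y = (x ⇒ y) ≡ 𝟙

  _∨₁_ : Carrier → Carrier → Carrier
  x ∨₁ y = (x ⇒ y) ⇝ y

  _∨₂_ : Carrier → Carrier → Carrier
  x ∨₂ y = (x ⇝ y) ⇒ y

record PseudoBEA (a : Level) : Set (suc a) where
  field
    pseudoBE : PseudoBE a
  open PseudoBE pseudoBE public
  field
    antitone⇒ : ∀ {x y} → x ≤ y → ∀ z → (y ⇒ z) ≤ (x ⇒ z)
    antitone⇝ : ∀ {x y} → x ≤ y → ∀ z → (y ⇝ z) ≤ (x ⇝ z)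

module _ {a : Level} (A : PseudoBE a) where
  open PseudoBE A

  record IsDeductiveSystem {ℓ : Level} (D : Carrier → Set ℓ) : Set (a ⊔ ℓ) where
    field
      contains-𝟙 : D 𝟙
      mp : ∀ {x y} → D x → D (x ⇒ y) → D y

  record IsFantastic {ℓ : Level} (D : Carrier → Set ℓ) : Set (a ⊔ ℓ) where
    field
      isDS : IsDeductiveSystem D
      fant₁ : ∀ x y → D (y ⇒ x) → D ((x ∨₁ y) ⇒ x)
      fant₂ : ∀ x y → D (y ⇝ x) → D ((x ∨₂ y) ⇝ x)

module Submission where

-- The proof has two halves, one per fantastic condition, and they are
-- mirror images of each other.  We therefore prove only the first one,
-- `fantastic₁-extends`, and obtain the second by duality:
--   * basic order facts and closure properties of deductive systems
--     (upward closure, modus ponens for ⇝) in an arbitrary pseudo-BE(A) algebra;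
--   * the core argument: given E (y → x) put u = y → x and w = u ⇝ x; then
--     y ≤ w and x ≤ w, so the fantastic condition for D at (w, y) together
--     with antitonicity yields E ((x ∨₁ y) → w) = E (u ⇝ ((x ∨₁ y) → x)),
--     and ⇝-modus ponens with E u finishes;
--   * the dual algebra (A, ⇝, →, 1), in which ∨₁ and ∨₂ trade places, is again
--     a pseudo-BE(A) algebra, and deductive systems of A are deductive
--     systems of the dual; the second fantastic condition of A is the first
--     fantastic condition of the dual.

open import Defs
open import Level using (Level; _⊔_)
open import Relation.Binary.PropositionalEquality
  using (_≡_; sym; trans; cong; subst)
open import Function.Bundles using (Equivalence)
open import Function.Properties.Equivalence using () renaming (sym to ⇔-sym)

module Basics {a : Level} (A : PseudoBEA a) where
  open PseudoBEA A

  ⇝-to-≤ : ∀ {x y} → (x ⇝ y) ≡ 𝟙 → x ≤ y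
  ⇝-to-≤ {x} {y} = Equivalence.from (⇒⇔⇝ x y)

  ≤-to-⇝ : ∀ {x y} → x ≤ y → (x ⇝ y) ≡ 𝟙
  ≤-to-⇝ {x} {y} = Equivalence.to (⇒⇔⇝ x y)

  ≤-⇝-eval : ∀ p q → p ≤ ((p ⇝ q) ⇒ q)
  ≤-⇝-eval p q = ⇝-to-≤ (trans (sym (exchange (p ⇝ q) p q)) (⇒-refl (p ⇝ q)))

  ≤-⇒-eval : ∀ y x → y ≤ ((y ⇒ x) ⇝ x)
  ≤-⇒-eval y x = trans (exchange y (y ⇒ x) x) (⇝-refl (y ⇒ x))

  ≤-⇝-weaken : ∀ u x → x ≤ (u ⇝ x)
  ≤-⇝-weaken u x = trans (exchange x u x) (trans (cong (u ⇝_) (⇒-refl x)) (⇝-top u))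

  module _ {ℓ : Level} {E : Carrier → Set ℓ} (dsE : IsDeductiveSystem pseudoBE E) where
    open IsDeductiveSystem dsE

    ds-contains-𝟙 : ∀ {p} → p ≡ 𝟙 → E p
    ds-contains-𝟙 p≡𝟙 = subst E (sym p≡𝟙) contains-𝟙

    ds-upward : ∀ {p q} → E p → p ≤ q → E q
    ds-upward ep p≤q = mp ep (ds-contains-𝟙 p≤q)

    ds-mp⇝ : ∀ {p q} → E p → E (p ⇝ q) → E q
    ds-mp⇝ {p} {q} ep epq = mp epq (ds-upward ep (≤-⇝-eval p q))

-- The core argument: the first fantastic condition passes from D to any
-- deductive system E ⊇ D.  Of D we only need 𝟙 ∈ D and that condition.
module Extension {a : Level} (A : PseudoBEA a) where
  open PseudoBEA A
  open Basics A

  Fantastic₁ : {ℓ : Level} → (Carrier → Set ℓ) → Set (a ⊔ ℓ)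
  Fantastic₁ D = ∀ x y → D (y ⇒ x) → D ((x ∨₁ y) ⇒ x)

  fantastic₁-extends : {ℓ₁ ℓ₂ : Level} {D : Carrier → Set ℓ₁} {E : Carrier → Set ℓ₂} →
    D 𝟙 → Fantastic₁ D → IsDeductiveSystem pseudoBE E → (∀ x → D x → E x) →
    Fantastic₁ E
  fantastic₁-extends {D = D} {E} D𝟙 fantD dsE D⊆E x y Eu =
    ds-mp⇝ dsE Eu (subst E (exchange (x ∨₁ y) u x) E[x∨₁y⇒w])
    where
    u = y ⇒ x
    w = u ⇝ x

    -- D contains y → w = 𝟙, hence the fantastic condition applies at (w, y).
    D[w∨₁y⇒w] : D ((w ∨₁ y) ⇒ w)
    D[w∨₁y⇒w] = fantD w y (subst D (sym (≤-⇒-eval y x)) D𝟙)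

    -- x ≤ w, and ∨₁ y is monotone (two antitone steps).
    x∨₁y≤w∨₁y : (x ∨₁ y) ≤ (w ∨₁ y)
    x∨₁y≤w∨₁y = antitone⇝ (antitone⇒ (≤-⇝-weaken u x) y) y

    E[x∨₁y⇒w] : E ((x ∨₁ y) ⇒ w)
    E[x∨₁y⇒w] = ds-upward dsE (D⊆E _ D[w∨₁y⇒w]) (antitone⇒ x∨₁y≤w∨₁y w)

-- The dual algebra (A, ⇝, →, 1): swapping the two implications preserves
-- all axioms; its ∨₁ is the ∨₂ of A and vice versa.
dual : {a : Level} → PseudoBEA a → PseudoBEA a
dual A = record
  { pseudoBE = record
    { Carrier = Carrier
    ; _⇒_ = _⇝_
    ; _⇝_ = _⇒_
    ; 𝟙 = 𝟙
    ; ⇒-refl = ⇝-refl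
    ; ⇝-refl = ⇒-refl
    ; ⇒-top = ⇝-top
    ; ⇝-top = ⇒-top
    ; ⇒-left = ⇝-left
    ; ⇝-left = ⇒-left
    ; exchange = λ x y z → sym (exchange y x z)
    ; ⇒⇔⇝ = λ x y → ⇔-sym (⇒⇔⇝ x y)
    }
  ; antitone⇒ = λ x⇝y z → ≤-to-⇝ (antitone⇝ (⇝-to-≤ x⇝y) z)
  ; antitone⇝ = λ x⇝y z → ≤-to-⇝ (antitone⇒ (⇝-to-≤ x⇝y) z)
  }
  where
  open PseudoBEA A
  open Basics A

ds-dual : {a ℓ : Level} (A : PseudoBEA a) {E : PseudoBEA.Carrier A → Set ℓ} →
  IsDeductiveSystem (PseudoBEA.pseudoBE A) E →
  IsDeductiveSystem (PseudoBEA.pseudoBE (dual A)) E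
ds-dual A dsE = record
  { contains-𝟙 = IsDeductiveSystem.contains-𝟙 dsE
  ; mp = Basics.ds-mp⇝ A dsE
  }

proposition5p4 : {a ℓ₁ ℓ₂ : Level} (A : PseudoBEA a)
    (D : PseudoBEA.Carrier A → Set ℓ₁) (E : PseudoBEA.Carrier A → Set ℓ₂) →
    IsFantastic (PseudoBEA.pseudoBE A) D →
    IsDeductiveSystem (PseudoBEA.pseudoBE A) E →
    (∀ x → D x → E x) →
    IsFantastic (PseudoBEA.pseudoBE A) E
proposition5p4 A D E fantD dsE D⊆E = record
  { isDS = dsE
  ; fant₁ = Extension.fantastic₁-extends A D𝟙 fant₁ dsE D⊆E
  ; fant₂ = Extension.fantastic₁-extends (dual A) D𝟙 fant₂ (ds-dual A dsE) D⊆E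
  }
  where
  open IsFantastic fantD
  D𝟙 : D (PseudoBEA.𝟙 A)
  D𝟙 = IsDeductiveSystem.contains-𝟙 isDS
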